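{- Let $n\ge 0$ and $m\ge 0$, let $1\le k\le n$, and let $\sigma$ be a $(k-1)$-simplex of $\mathcal{B}_n^m$. Then $\mathrm{Link}_{\mathcal{B}_n^m}(\sigma)$ is isomorphic to $\mathcal{B}_{n-k}^{m+k}$.
   Context: A line in $\mathbb{Z}^N$ is a set $\{v,-v\}$ with $v$ primitive, written $\langle v\rangle$. A partial frame for $\mathbb{Z}^N$ is a set of lines $\{\langle v_1\rangle,\ldots,\langle v_k\rangle\}$ such that $\{v_1,\ldots,v_k\}$ is a basis of a direct summand of $\mathbb{Z}^N$. $\mathcal{B}_N$ is the simplicial complex whose $p$-simplices are partial frames of cardinality $p+1$. With $e_1,\ldots,e_{m+n}$ the standard basis of $\mathbb{Z}^{m+n}$, $\mathcal{B}_n^m=\mathrm{Link}_{\mathcal{B}_{m+n}}(\{\langle e_1\rangle,\ldots,\langle e_m\rangle\})$. -}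

module Defs where

open import Data.Nat using (ℕ; zero; suc) renaming (_+_ to _+ℕ_)
open import Data.Integer using (ℤ; +_; _+_; _*_; -_)
open import Data.Fin using (Fin; _↑ˡ_)
open import Data.Fin.Properties using (_≟_)
open import Data.Vec using (Vec; replicate; zipWith; tabulate)
import Data.Vec as Vec
open import Data.List using (List; []; _∷_; map; length; _++_; allFin)
open import Data.List.Relation.Unary.All using (All)
open import Data.List.Relation.Unary.Any using (Any)
open import Data.Product using (Σ; _×_; ∃; ∃₂; _,_)
open import Data.Sum using (_⊎_)
open import Data.Bool using (if_then_else_)
open import Relation.Nullary using (¬_; does)
open import Relation.Binary.PropositionalEquality using (_≡_)

0ᵥ : (N : ℕ) → Vec ℤ N
0ᵥ N = replicate N (+ 0)

_+ᵥ_ : {N : ℕ} → Vec ℤ N → Vec ℤ N → Vec ℤ N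
_+ᵥ_ = zipWith _+_

-ᵥ_ : {N : ℕ} → Vec ℤ N → Vec ℤ N
-ᵥ_ = Vec.map -_

_·ᵥ_ : {N : ℕ} → ℤ → Vec ℤ N → Vec ℤ N
c ·ᵥ v = Vec.map (c *_) v

lincomb : {N : ℕ} → List ℤ → List (Vec ℤ N) → Vec ℤ N
lincomb {N} (c ∷ cs) (v ∷ vs) = (c ·ᵥ v) +ᵥ lincomb cs vs
lincomb {N} _ _ = 0ᵥ N

Independent : {N : ℕ} → List (Vec ℤ N) → Set
Independent {N} vs =
  (cs : List ℤ) → length cs ≡ length vs → lincomb cs vs ≡ 0ᵥ N → All (_≡ + 0) cs

Span : {N : ℕ} → List (Vec ℤ N) → Vec ℤ N → Set
Span vs x = Σ (List ℤ) λ cs → length cs ≡ length vs × lincomb cs vs ≡ x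

record Subgroup (N : ℕ) : Set₁ where
  field
    _∈S : Vec ℤ N → Set
    0∈  : 0ᵥ N ∈S
    +∈  : ∀ x y → x ∈S → y ∈S → (x +ᵥ y) ∈S
    -∈  : ∀ x → x ∈S → (-ᵥ x) ∈S
open Subgroup public

IsDirectSummand : {N : ℕ} → (Vec ℤ N → Set) → Set₁
IsDirectSummand {N} A =
  Σ (Subgroup N) λ B →
    ((x : Vec ℤ N) → A x → _∈S B x → x ≡ 0ᵥ N) ×
    ((x : Vec ℤ N) → ∃₂ λ a b → A a × _∈S B b × x ≡ (a +ᵥ b))

PartialFrame : {N : ℕ} → List (Vec ℤ N) → Set₁
PartialFrame vs = Independent vs × IsDirectSummand (Span vs)

-- Raw vertices have type V; _≈_ identifies raw vertices representing the
-- same vertex.  IsFace xs means: xs is a duplicate-free listing of the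
-- vertices of a simplex.  The vertices of the complex are the x with
-- IsFace (x ∷ []).

record Complex : Set₂ where
  field
    V      : Set
    _≈_    : V → V → Set
    IsFace : List V → Set₁
open Complex public

record _≅_ (K L : Complex) : Set₁ where
  field
    to        : V K → V L
    from      : V L → V K
    to-resp   : ∀ x y → _≈_ K x y → _≈_ L (to x) (to y)
    from-resp : ∀ x y → _≈_ L x y → _≈_ K (from x) (from y)
    to-face   : ∀ xs → IsFace K xs → IsFace L (map to xs)
    from-face : ∀ ys → IsFace L ys → IsFace K (map from ys)
    from-to   : ∀ x → IsFace K (x ∷ []) → _≈_ K (from (to x)) x
    to-from   : ∀ y → IsFace L (y ∷ []) → _≈_ L (to (from y)) y

Link : (K : Complex) → List (V K) → Complex
Link K σ = record
  { V      = V K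
  ; _≈_    = _≈_ K
  ; IsFace = λ τ → All (λ v → ¬ Any (_≈_ K v) σ) τ × IsFace K (τ ++ σ)
  }

-- The complex 𝓑_N: vertices are lines ⟨v⟩ = {v, -v}, represented by v
-- (v ≈ w iff w = ±v); simplices are partial frames.

𝓑 : ℕ → Complex
𝓑 N = record
  { V      = Vec ℤ N
  ; _≈_    = λ v w → v ≡ w ⊎ v ≡ (-ᵥ w)
  ; IsFace = PartialFrame
  }

e : (N : ℕ) → Fin N → Vec ℤ N
e N i = tabulate λ j → if does (i ≟ j) then + 1 else + 0

Eframe : (m n : ℕ) → List (Vec ℤ (m +ℕ n))
Eframe m n = map (λ i → e (m +ℕ n) (i ↑ˡ n)) (allFin m)

𝓑[_,_] : (n m : ℕ) → Complex
𝓑[ n , m ] = Link (𝓑 (m +ℕ n)) (Eframe m n)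

module Submission where

-- 𝓑ⁿ_m is the link in 𝓑_N (N = m+n) of the standard frame E_m = {e_0,…,e_{m-1}}, and a
-- link of a link is read off from partial frames: τ is a face of Link(Link_𝓑(E)) σ iff
-- τ ∪ σ ∪ E is a partial frame.  Linear automorphisms of ℤ^N and reorderings preserve
-- partial frames.  Let σ = v ∷ σ′.  Bézout operations on pairs of coordinates (m, j),
-- j > m, clear the coordinates of v above m without moving E_m; the resulting w has
-- w - w_m e_m in the span of E_m, and the direct-summand property forces w_m = ±1, so a
-- column operation sends w to e_m.  This automorphism moves v into the frame:
-- Link(Link_𝓑(E_m)) (v ∷ σ′) ≅ Link(Link_𝓑(E_{m+1})) (A σ′).  Induction on the length of
-- σ gives Link(Link_𝓑(E_m)) σ ≅ Link_𝓑(E_{m+k}) = 𝓑ⁿ⁻ᵏ_{m+k}, up to reordering frames and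
-- writing m+n as (m+k)+(n-k).

open import Data.Bool using (if_then_else_)
open import Data.Empty using (⊥; ⊥-elim)
open import Data.Fin as F using (Fin; zero; suc; toℕ)
import Data.Fin.Properties as FinP
open import Data.Integer as ℤ using (ℤ; +_; -[1+_]; _+_; _*_; -_; _-_; ∣_∣)
import Data.Integer.Properties as ℤP
open import Data.Integer.Tactic.RingSolver using (solve-∀)
open import Data.List as L using (List; []; _∷_; _++_; length; map)
open import Data.List.Membership.Propositional using (_∈_; find)
import Data.List.Membership.Propositional.Properties as ∈P
import Data.List.Properties as ListP
open import Data.List.Relation.Binary.Permutation.Propositional as ↭
  using (_↭_; prep; swap; ↭-sym; ↭-refl)
import Data.List.Relation.Binary.Permutation.Propositional.Properties as ↭P
open import Data.List.Relation.Unary.All as All using (All; []; _∷_)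
import Data.List.Relation.Unary.All.Properties as AllP
open import Data.List.Relation.Unary.Any using (Any; here; there)
import Data.List.Relation.Unary.Any.Properties as AnyP
open import Data.Nat as ℕ using (ℕ; zero; suc; z≤n; s≤s)
import Data.Nat.Properties as ℕP
open import Data.Nat.Divisibility using (divides)
open import Data.Nat.GCD using (module GCD; module Bézout)
open import Data.Product using (Σ; _×_; ∃₂; _,_; proj₁; proj₂)
open import Data.Sum using (_⊎_; inj₁; inj₂)
open import Data.Vec as V using (Vec; []; _∷_; lookup)
import Data.Vec.Properties as VecP
open import Defs
open import Function using (id)
open import Relation.Binary.PropositionalEquality hiding (J)
open import Relation.Nullary using (¬_; yes; no; does; Dec)
open import Relation.Nullary.Decidable using (dec-true; dec-false)

≡-pointwise : ∀ {N} {u w : Vec ℤ N} → (∀ i → lookup u i ≡ lookup w i) → u ≡ w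
≡-pointwise {u = u} {w} h =
  trans (sym (VecP.tabulate∘lookup u)) (trans (VecP.tabulate-cong h) (VecP.tabulate∘lookup w))

lookup-+ᵥ : ∀ {N} (u w : Vec ℤ N) i → lookup (u +ᵥ w) i ≡ lookup u i + lookup w i
lookup-+ᵥ u w i = VecP.lookup-zipWith _+_ i u w

lookup-·ᵥ : ∀ {N} c (u : Vec ℤ N) i → lookup (c ·ᵥ u) i ≡ c * lookup u i
lookup-·ᵥ c u i = VecP.lookup-map i (c *_) u

lookup-0ᵥ : ∀ N (i : Fin N) → lookup (0ᵥ N) i ≡ + 0
lookup-0ᵥ N i = VecP.lookup-replicate i (+ 0)

+ᵥ-assoc : ∀ {N} (a b c : Vec ℤ N) → ((a +ᵥ b) +ᵥ c) ≡ (a +ᵥ (b +ᵥ c))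
+ᵥ-assoc = VecP.zipWith-assoc ℤP.+-assoc

+ᵥ-comm : ∀ {N} (a b : Vec ℤ N) → (a +ᵥ b) ≡ (b +ᵥ a)
+ᵥ-comm = VecP.zipWith-comm ℤP.+-comm

+ᵥ-identityˡ : ∀ {N} (a : Vec ℤ N) → (0ᵥ N +ᵥ a) ≡ a
+ᵥ-identityˡ = VecP.zipWith-identityˡ ℤP.+-identityˡ

+ᵥ-identityʳ : ∀ {N} (a : Vec ℤ N) → (a +ᵥ 0ᵥ N) ≡ a
+ᵥ-identityʳ = VecP.zipWith-identityʳ ℤP.+-identityʳ

+ᵥ-inverseʳ : ∀ {N} (a : Vec ℤ N) → (a +ᵥ (-ᵥ a)) ≡ 0ᵥ N
+ᵥ-inverseʳ = VecP.zipWith-inverseʳ ℤP.+-inverseʳ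

+ᵥ-swapˡ : ∀ {N} (a b c : Vec ℤ N) → (a +ᵥ (b +ᵥ c)) ≡ (b +ᵥ (a +ᵥ c))
+ᵥ-swapˡ a b c =
  trans (sym (+ᵥ-assoc a b c)) (trans (cong (_+ᵥ c) (+ᵥ-comm a b)) (+ᵥ-assoc b a c))

·ᵥ-distribˡ : ∀ {N} c (a b : Vec ℤ N) → (c ·ᵥ (a +ᵥ b)) ≡ ((c ·ᵥ a) +ᵥ (c ·ᵥ b))
·ᵥ-distribˡ c [] [] = refl
·ᵥ-distribˡ c (x ∷ a) (y ∷ b) = cong₂ _∷_ (ℤP.*-distribˡ-+ c x y) (·ᵥ-distribˡ c a b)

·ᵥ-distribʳ : ∀ {N} c d (a : Vec ℤ N) → ((c + d) ·ᵥ a) ≡ ((c ·ᵥ a) +ᵥ (d ·ᵥ a))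
·ᵥ-distribʳ c d [] = refl
·ᵥ-distribʳ c d (x ∷ a) = cong₂ _∷_ (ℤP.*-distribʳ-+ x c d) (·ᵥ-distribʳ c d a)

·ᵥ-zeroʳ : ∀ {N} c → (c ·ᵥ 0ᵥ N) ≡ 0ᵥ N
·ᵥ-zeroʳ {N} c = trans (VecP.map-replicate (c *_) (+ 0) N) (cong (V.replicate N) (ℤP.*-zeroʳ c))

·ᵥ-zeroˡ : ∀ {N} (a : Vec ℤ N) → ((+ 0) ·ᵥ a) ≡ 0ᵥ N
·ᵥ-zeroˡ [] = refl
·ᵥ-zeroˡ (x ∷ a) = cong (+ 0 ∷_) (·ᵥ-zeroˡ a)

·ᵥ-identityˡ : ∀ {N} (a : Vec ℤ N) → ((+ 1) ·ᵥ a) ≡ a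
·ᵥ-identityˡ a = trans (VecP.map-cong ℤP.*-identityˡ a) (VecP.map-id a)

·ᵥ-assoc : ∀ {N} c d (a : Vec ℤ N) → (c ·ᵥ (d ·ᵥ a)) ≡ ((c * d) ·ᵥ a)
·ᵥ-assoc c d a =
  trans (sym (VecP.map-∘ (c *_) (d *_) a)) (VecP.map-cong (λ x → sym (ℤP.*-assoc c d x)) a)

-ᵥ≡-1·ᵥ : ∀ {N} (a : Vec ℤ N) → (-ᵥ a) ≡ (ℤ.-1ℤ ·ᵥ a)
-ᵥ≡-1·ᵥ a = VecP.map-cong (λ x → sym (ℤP.-1*i≡-i x)) a

-ᵥ-involutive : ∀ {N} (a : Vec ℤ N) → (-ᵥ (-ᵥ a)) ≡ a
-ᵥ-involutive a =
  trans (sym (VecP.map-∘ -_ -_ a)) (trans (VecP.map-cong ℤP.neg-involutive a) (VecP.map-id a))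

lincomb-zeros : ∀ {N} k (vs : List (Vec ℤ N)) → lincomb (L.replicate k (+ 0)) vs ≡ 0ᵥ N
lincomb-zeros zero vs = refl
lincomb-zeros (suc k) [] = refl
lincomb-zeros (suc k) (v ∷ vs) =
  trans (cong₂ _+ᵥ_ (·ᵥ-zeroˡ v) (lincomb-zeros k vs)) (+ᵥ-identityˡ _)

lincomb-++ : ∀ {N} (cs ds : List ℤ) (xs ys : List (Vec ℤ N)) → length cs ≡ length xs →
             lincomb (cs ++ ds) (xs ++ ys) ≡ (lincomb cs xs +ᵥ lincomb ds ys)
lincomb-++ [] ds [] ys _ = sym (+ᵥ-identityˡ _)
lincomb-++ (c ∷ cs) ds (x ∷ xs) ys eq =
  trans (cong ((c ·ᵥ x) +ᵥ_) (lincomb-++ cs ds xs ys (ℕP.suc-injective eq)))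
        (sym (+ᵥ-assoc _ _ _))

lincomb-scale : ∀ {N} c (cs : List ℤ) (vs : List (Vec ℤ N)) →
                lincomb (map (c *_) cs) vs ≡ (c ·ᵥ lincomb cs vs)
lincomb-scale c [] vs = sym (·ᵥ-zeroʳ c)
lincomb-scale c (x ∷ cs) [] = sym (·ᵥ-zeroʳ c)
lincomb-scale c (x ∷ cs) (v ∷ vs) =
  trans (cong₂ _+ᵥ_ (sym (·ᵥ-assoc c x v)) (lincomb-scale c cs vs)) (sym (·ᵥ-distribˡ c _ _))

lincomb-+ : ∀ {N} (cs ds : List ℤ) (vs : List (Vec ℤ N)) →
            length cs ≡ length vs → length ds ≡ length vs →
            lincomb (L.zipWith _+_ cs ds) vs ≡ (lincomb cs vs +ᵥ lincomb ds vs)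
lincomb-+ [] [] [] _ _ = sym (+ᵥ-identityˡ _)
lincomb-+ (c ∷ cs) (d ∷ ds) (v ∷ vs) l₁ l₂ = begin
  ((c + d) ·ᵥ v) +ᵥ lincomb (L.zipWith _+_ cs ds) vs
    ≡⟨ cong₂ _+ᵥ_ (·ᵥ-distribʳ c d v) (lincomb-+ cs ds vs (ℕP.suc-injective l₁) (ℕP.suc-injective l₂)) ⟩
  ((c ·ᵥ v) +ᵥ (d ·ᵥ v)) +ᵥ (lincomb cs vs +ᵥ lincomb ds vs)
    ≡⟨ +ᵥ-assoc _ _ _ ⟩
  (c ·ᵥ v) +ᵥ ((d ·ᵥ v) +ᵥ (lincomb cs vs +ᵥ lincomb ds vs))
    ≡⟨ cong ((c ·ᵥ v) +ᵥ_) (+ᵥ-swapˡ _ _ _) ⟩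
  (c ·ᵥ v) +ᵥ (lincomb cs vs +ᵥ ((d ·ᵥ v) +ᵥ lincomb ds vs))
    ≡⟨ sym (+ᵥ-assoc _ _ _) ⟩
  ((c ·ᵥ v) +ᵥ lincomb cs vs) +ᵥ ((d ·ᵥ v) +ᵥ lincomb ds vs) ∎
  where open ≡-Reasoning

length-zipWith-+ : ∀ (cs ds : List ℤ) {n} → length cs ≡ n → length ds ≡ n →
                   length (L.zipWith _+_ cs ds) ≡ n
length-zipWith-+ cs ds {n} refl l₂ =
  trans (ListP.length-zipWith _+_ cs ds) (trans (cong (length cs ℕ.⊓_) l₂) (ℕP.⊓-idem n))

span-+ : ∀ {N} (vs : List (Vec ℤ N)) {x y} → Span vs x → Span vs y → Span vs (x +ᵥ y)
span-+ vs (cs , l₁ , e₁) (ds , l₂ , e₂) =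
  L.zipWith _+_ cs ds , length-zipWith-+ cs ds l₁ l₂ , trans (lincomb-+ cs ds vs l₁ l₂) (cong₂ _+ᵥ_ e₁ e₂)

span-· : ∀ {N} (vs : List (Vec ℤ N)) c {x} → Span vs x → Span vs (c ·ᵥ x)
span-· vs c (cs , l , e) =
  map (c *_) cs , trans (ListP.length-map (c *_) cs) l , trans (lincomb-scale c cs vs) (cong (c ·ᵥ_) e)

span-head : ∀ {N} (w : Vec ℤ N) R → Span (w ∷ R) w
span-head w R =
  + 1 ∷ L.replicate (length R) (+ 0) , cong suc (ListP.length-replicate (length R)) ,
  trans (cong₂ _+ᵥ_ (·ᵥ-identityˡ w) (lincomb-zeros (length R) R)) (+ᵥ-identityʳ w)

span-tail : ∀ {N} (w : Vec ℤ N) R {x} → Span R x → Span (w ∷ R) x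
span-tail w R (cs , l , e) = + 0 ∷ cs , cong suc l , trans (cong₂ _+ᵥ_ (·ᵥ-zeroˡ w) e) (+ᵥ-identityˡ _)

span-++ʳ : ∀ {N} (S R : List (Vec ℤ N)) {x} → Span R x → Span (S ++ R) x
span-++ʳ [] R s = s
span-++ʳ (w ∷ S) R s = span-tail w (S ++ R) (span-++ʳ S R s)

subgroup-·ℕ : ∀ {N} (B : Subgroup N) (n : ℕ) x → _∈S B x → _∈S B ((+ n) ·ᵥ x)
subgroup-·ℕ B zero x b = subst (_∈S B) (sym (·ᵥ-zeroˡ x)) (0∈ B)
subgroup-·ℕ B (suc n) x b = subst (_∈S B) eq (+∈ B x _ b (subgroup-·ℕ B n x b))
  where
  eq : (x +ᵥ ((+ n) ·ᵥ x)) ≡ ((+ suc n) ·ᵥ x)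
  eq = trans (cong (_+ᵥ ((+ n) ·ᵥ x)) (sym (·ᵥ-identityˡ x))) (sym (·ᵥ-distribʳ (+ 1) (+ n) x))

subgroup-· : ∀ {N} (B : Subgroup N) c x → _∈S B x → _∈S B (c ·ᵥ x)
subgroup-· B (+ n) x b = subgroup-·ℕ B n x b
subgroup-· B -[1+ n ] x b = subst (_∈S B) eq (-∈ B _ (subgroup-·ℕ B (suc n) x b))
  where
  eq : (-ᵥ ((+ suc n) ·ᵥ x)) ≡ (-[1+ n ] ·ᵥ x)
  eq = trans (-ᵥ≡-1·ᵥ _) (trans (·ᵥ-assoc ℤ.-1ℤ (+ suc n) x) (cong (_·ᵥ x) (ℤP.-1*i≡-i (+ suc n))))

indicator : ∀ {N} {x : Vec ℤ N} {xs} → x ∈ xs → List ℤ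
indicator {xs = _ ∷ xs} (here _) = + 1 ∷ L.replicate (length xs) (+ 0)
indicator (there p) = + 0 ∷ indicator p

length-indicator : ∀ {N} {x : Vec ℤ N} {xs} (p : x ∈ xs) → length (indicator p) ≡ length xs
length-indicator {xs = _ ∷ xs} (here _) = cong suc (ListP.length-replicate (length xs))
length-indicator (there p) = cong suc (length-indicator p)

lincomb-indicator : ∀ {N} {x : Vec ℤ N} {xs} (p : x ∈ xs) → lincomb (indicator p) xs ≡ x
lincomb-indicator {xs = w ∷ xs} (here refl) =
  trans (cong₂ _+ᵥ_ (·ᵥ-identityˡ w) (lincomb-zeros (length xs) xs)) (+ᵥ-identityʳ w)
lincomb-indicator {xs = w ∷ xs} (there p) =
  trans (cong₂ _+ᵥ_ (·ᵥ-zeroˡ w) (lincomb-indicator p)) (+ᵥ-identityˡ _)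

indicator-nonzero : ∀ {N} {x : Vec ℤ N} {xs} (p : x ∈ xs) → ¬ All (_≡ + 0) (indicator p)
indicator-nonzero (here _) (() ∷ _)
indicator-nonzero (there p) (_ ∷ zs) = indicator-nonzero p zs

head-coefficient-zero : ∀ {N} (w : Vec ℤ N) R → Independent (w ∷ R) →
                        ∀ c → Span R (c ·ᵥ w) → c ≡ + 0
head-coefficient-zero {N} w R ind c (cs , l , e) =
  All.head (ind (c ∷ map (ℤ.-1ℤ *_) cs) (cong suc (trans (ListP.length-map _ cs) l)) combination)
  where
  combination : ((c ·ᵥ w) +ᵥ lincomb (map (ℤ.-1ℤ *_) cs) R) ≡ 0ᵥ N
  combination = trans (cong ((c ·ᵥ w) +ᵥ_)
      (trans (lincomb-scale ℤ.-1ℤ cs R) (trans (cong (ℤ.-1ℤ ·ᵥ_) e) (sym (-ᵥ≡-1·ᵥ _)))))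
    (+ᵥ-inverseʳ _)

_≈ₗ_ : ∀ {N} → Vec ℤ N → Vec ℤ N → Set
v ≈ₗ w = v ≡ w ⊎ v ≡ (-ᵥ w)

≈ₗ-trans : ∀ {N} {x y z : Vec ℤ N} → x ≈ₗ y → y ≈ₗ z → x ≈ₗ z
≈ₗ-trans (inj₁ refl) q = q
≈ₗ-trans (inj₂ refl) (inj₁ refl) = inj₂ refl
≈ₗ-trans (inj₂ refl) (inj₂ refl) = inj₁ (-ᵥ-involutive _)

cancelling-coefficient : ∀ {N} {y z : Vec ℤ N} → y ≈ₗ z → ℤ
cancelling-coefficient (inj₁ _) = ℤ.-1ℤ
cancelling-coefficient (inj₂ _) = + 1

cancelling-combination : ∀ {N} {y z : Vec ℤ N} (yz : y ≈ₗ z) →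
                         (y +ᵥ (cancelling-coefficient yz ·ᵥ z)) ≡ 0ᵥ N
cancelling-combination {y = y} (inj₁ refl) = trans (cong (y +ᵥ_) (sym (-ᵥ≡-1·ᵥ y))) (+ᵥ-inverseʳ y)
cancelling-combination {z = z} (inj₂ refl) =
  trans (+ᵥ-comm _ _) (trans (cong (_+ᵥ (-ᵥ z)) (·ᵥ-identityˡ z)) (+ᵥ-inverseʳ z))

independent⇒disjoint : ∀ {N} (ys zs : List (Vec ℤ N)) → Independent (ys ++ zs) →
                       All (λ y → ¬ Any (y ≈ₗ_) zs) ys
independent⇒disjoint {N} ys zs ind = All.tabulate λ y∈ any → contradiction y∈ (find any)
  where
  contradiction : ∀ {y} → y ∈ ys → Σ (Vec ℤ N) (λ z → z ∈ zs × y ≈ₗ z) → ⊥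
  contradiction {y} y∈ (z , z∈ , yz) =
    indicator-nonzero y∈ (AllP.++⁻ˡ (indicator y∈) (ind cs same-length vanishes))
    where
    c = cancelling-coefficient yz
    cs = indicator y∈ ++ map (c *_) (indicator z∈)
    same-length : length cs ≡ length (ys ++ zs)
    same-length = begin
      length cs                                        ≡⟨ ListP.length-++ (indicator y∈) ⟩
      length (indicator y∈) ℕ.+ length (map (c *_) (indicator z∈))
        ≡⟨ cong₂ ℕ._+_ (length-indicator y∈) (trans (ListP.length-map _ (indicator z∈)) (length-indicator z∈)) ⟩
      length ys ℕ.+ length zs                          ≡⟨ sym (ListP.length-++ ys) ⟩
      length (ys ++ zs)                                ∎
      where open ≡-Reasoning
    vanishes : lincomb cs (ys ++ zs) ≡ 0ᵥ N
    vanishes = begin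
      lincomb cs (ys ++ zs)
        ≡⟨ lincomb-++ (indicator y∈) _ ys zs (length-indicator y∈) ⟩
      lincomb (indicator y∈) ys +ᵥ lincomb (map (c *_) (indicator z∈)) zs
        ≡⟨ cong₂ _+ᵥ_ (lincomb-indicator y∈) (lincomb-scale c (indicator z∈) zs) ⟩
      y +ᵥ (c ·ᵥ lincomb (indicator z∈) zs)
        ≡⟨ cong (λ t → y +ᵥ (c ·ᵥ t)) (lincomb-indicator z∈) ⟩
      y +ᵥ (c ·ᵥ z)
        ≡⟨ cancelling-combination yz ⟩
      0ᵥ N ∎
      where open ≡-Reasoning

lincomb-↭ : ∀ {N} {xs ys : List (Vec ℤ N)} → xs ↭ ys → (cs : List ℤ) → length cs ≡ length xs →
            Σ (List ℤ) λ ds → length ds ≡ length ys × lincomb ds ys ≡ lincomb cs xs × cs ↭ ds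
lincomb-↭ ↭.refl cs l = cs , l , refl , ↭-refl
lincomb-↭ (prep x p) (c ∷ cs) l with lincomb-↭ p cs (ℕP.suc-injective l)
... | ds , l′ , e , q = c ∷ ds , cong suc l′ , cong ((c ·ᵥ x) +ᵥ_) e , prep c q
lincomb-↭ (swap x y p) (c₁ ∷ c₂ ∷ cs) l
  with lincomb-↭ p cs (ℕP.suc-injective (ℕP.suc-injective l))
... | ds , l′ , e , q =
  c₂ ∷ c₁ ∷ ds , cong (λ k → suc (suc k)) l′ ,
  trans (+ᵥ-swapˡ _ _ _) (cong (λ t → (c₁ ·ᵥ x) +ᵥ ((c₂ ·ᵥ y) +ᵥ t)) e) , swap c₁ c₂ q
lincomb-↭ (↭.trans p q) cs l with lincomb-↭ p cs l
... | ds , l′ , e , r with lincomb-↭ q ds l′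
... | es , l″ , e′ , r′ = es , l″ , trans e′ e , ↭.trans r r′

Independent-↭ : ∀ {N} {xs ys : List (Vec ℤ N)} → xs ↭ ys → Independent xs → Independent ys
Independent-↭ p ind ds l e with lincomb-↭ (↭-sym p) ds l
... | cs , l′ , e′ , q = ↭P.All-resp-↭ (↭-sym q) (ind cs l′ (trans e′ e))

Span-↭ : ∀ {N} {xs ys : List (Vec ℤ N)} → xs ↭ ys → ∀ {x} → Span xs x → Span ys x
Span-↭ p (cs , l , e) with lincomb-↭ p cs l
... | ds , l′ , e′ , _ = ds , l′ , trans e′ e

PartialFrame-↭ : ∀ {N} {xs ys : List (Vec ℤ N)} → xs ↭ ys → PartialFrame xs → PartialFrame ys
PartialFrame-↭ p (ind , B , disjoint , covers) =
  Independent-↭ p ind ,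
  B , (λ x sp b → disjoint x (Span-↭ (↭-sym p) sp) b) ,
  (λ x → let (a , b , sa , bb , eq) = covers x in a , b , Span-↭ p sa , bb , eq)

record IsLinear {N : ℕ} (h : Vec ℤ N → Vec ℤ N) : Set where
  field
    additive    : ∀ x y → h (x +ᵥ y) ≡ (h x +ᵥ h y)
    homogeneous : ∀ c x → h (c ·ᵥ x) ≡ (c ·ᵥ h x)

  preserves-0 : h (0ᵥ N) ≡ 0ᵥ N
  preserves-0 = trans (cong h (sym (·ᵥ-zeroˡ (0ᵥ N)))) (trans (homogeneous (+ 0) _) (·ᵥ-zeroˡ _))

  preserves-neg : ∀ x → h (-ᵥ x) ≡ (-ᵥ h x)
  preserves-neg x = trans (cong h (-ᵥ≡-1·ᵥ x)) (trans (homogeneous ℤ.-1ℤ x) (sym (-ᵥ≡-1·ᵥ (h x))))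

  preserves-lincomb : ∀ cs vs → lincomb cs (map h vs) ≡ h (lincomb cs vs)
  preserves-lincomb [] vs = sym preserves-0
  preserves-lincomb (c ∷ cs) [] = sym preserves-0
  preserves-lincomb (c ∷ cs) (v ∷ vs) =
    trans (cong₂ _+ᵥ_ (sym (homogeneous c v)) (preserves-lincomb cs vs)) (sym (additive _ _))

  preserves-≈ₗ : ∀ {x y} → x ≈ₗ y → h x ≈ₗ h y
  preserves-≈ₗ (inj₁ refl) = inj₁ refl
  preserves-≈ₗ (inj₂ refl) = inj₂ (preserves-neg _)

record LinAut (N : ℕ) : Set where
  field
    f f⁻¹      : Vec ℤ N → Vec ℤ N
    f-linear   : IsLinear f
    f⁻¹-linear : IsLinear f⁻¹
    f⁻¹∘f      : ∀ x → f⁻¹ (f x) ≡ x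
    f∘f⁻¹      : ∀ x → f (f⁻¹ x) ≡ x

  f⁻¹∘f-list : ∀ xs → map f⁻¹ (map f xs) ≡ xs
  f⁻¹∘f-list xs = trans (sym (ListP.map-∘ xs)) (trans (ListP.map-cong f⁻¹∘f xs) (ListP.map-id xs))

idAut : ∀ {N} → LinAut N
idAut = record { f = id ; f⁻¹ = id ; f-linear = id-linear ; f⁻¹-linear = id-linear
               ; f⁻¹∘f = λ _ → refl ; f∘f⁻¹ = λ _ → refl }
  where
  id-linear : IsLinear id
  id-linear = record { additive = λ _ _ → refl ; homogeneous = λ _ _ → refl }

_⁻¹ᴬ : ∀ {N} → LinAut N → LinAut N
A ⁻¹ᴬ = record { f = f⁻¹ ; f⁻¹ = f ; f-linear = f⁻¹-linear ; f⁻¹-linear = f-linear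
               ; f⁻¹∘f = f∘f⁻¹ ; f∘f⁻¹ = f⁻¹∘f }
  where open LinAut A

-- A ∘ᴬ B applies B first.
_∘ᴬ_ : ∀ {N} → LinAut N → LinAut N → LinAut N
A ∘ᴬ B = record
  { f = λ x → A.f (B.f x) ; f⁻¹ = λ x → B.f⁻¹ (A.f⁻¹ x)
  ; f-linear = compose A.f-linear B.f-linear ; f⁻¹-linear = compose B.f⁻¹-linear A.f⁻¹-linear
  ; f⁻¹∘f = λ x → trans (cong B.f⁻¹ (A.f⁻¹∘f _)) (B.f⁻¹∘f x)
  ; f∘f⁻¹ = λ x → trans (cong A.f (B.f∘f⁻¹ _)) (A.f∘f⁻¹ x) }
  where
  module A = LinAut A
  module B = LinAut B
  compose : ∀ {N} {g h : Vec ℤ N → Vec ℤ N} → IsLinear g → IsLinear h → IsLinear (λ x → g (h x))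
  compose {g = g} G H = record
    { additive = λ x y → trans (cong g (IsLinear.additive H x y)) (IsLinear.additive G _ _)
    ; homogeneous = λ c x → trans (cong g (IsLinear.homogeneous H c x)) (IsLinear.homogeneous G c _) }

module _ {N : ℕ} (A : LinAut N) where
  open LinAut A
  open IsLinear

  Span-map⁻ : ∀ xs {y} → Span (map f xs) y → Span xs (f⁻¹ y)
  Span-map⁻ xs (cs , l , e) = cs , trans l (ListP.length-map f xs) ,
    trans (sym (f⁻¹∘f _)) (cong f⁻¹ (trans (sym (preserves-lincomb f-linear cs xs)) e))

  Span-map⁺ : ∀ xs {x} → Span xs x → Span (map f xs) (f x)
  Span-map⁺ xs (cs , l , e) = cs , trans l (sym (ListP.length-map f xs)) ,
    trans (preserves-lincomb f-linear cs xs) (cong f e)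

  -- The complement of the image summand is the image of the complement.
  PartialFrame-map : ∀ xs → PartialFrame xs → PartialFrame (map f xs)
  PartialFrame-map xs (ind , B , disjoint , covers) = ind′ , B′ , disjoint′ , covers′
    where
    ind′ : Independent (map f xs)
    ind′ cs l e = ind cs (trans l (ListP.length-map f xs))
      (trans (sym (f⁻¹∘f _)) (trans (cong f⁻¹ (trans (sym (preserves-lincomb f-linear cs xs)) e))
                                    (preserves-0 f⁻¹-linear)))
    B′ : Subgroup N
    B′ = record
      { _∈S = λ y → _∈S B (f⁻¹ y)
      ; 0∈ = subst (_∈S B) (sym (preserves-0 f⁻¹-linear)) (0∈ B)
      ; +∈ = λ x y bx by → subst (_∈S B) (sym (additive f⁻¹-linear x y)) (+∈ B _ _ bx by)
      ; -∈ = λ x bx → subst (_∈S B) (sym (preserves-neg f⁻¹-linear x)) (-∈ B _ bx) }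
    disjoint′ : (x : Vec ℤ N) → Span (map f xs) x → _∈S B′ x → x ≡ 0ᵥ N
    disjoint′ y sp by =
      trans (sym (f∘f⁻¹ y)) (trans (cong f (disjoint (f⁻¹ y) (Span-map⁻ xs sp) by)) (preserves-0 f-linear))
    covers′ : (x : Vec ℤ N) → ∃₂ λ a b → Span (map f xs) a × _∈S B′ b × x ≡ (a +ᵥ b)
    covers′ y with covers (f⁻¹ y)
    ... | a , b , sa , bb , eq =
      f a , f b , Span-map⁺ xs sa , subst (_∈S B) (sym (f⁻¹∘f b)) bb ,
      trans (sym (f∘f⁻¹ y)) (trans (cong f eq) (additive f-linear a b))

-- Complexes of lines.  𝓑_N and all its (iterated) links have vertex set ℤ^N with
-- the relation ≈ₗ; they differ only in their faces.

LineComplex : (N : ℕ) → (List (Vec ℤ N) → Set₁) → Complex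
LineComplex N P = record { V = Vec ℤ N ; _≈_ = _≈ₗ_ ; IsFace = P }

≅-trans : ∀ {N₁ N₂ N₃} {P : List (Vec ℤ N₁) → Set₁} {Q : List (Vec ℤ N₂) → Set₁}
            {R : List (Vec ℤ N₃) → Set₁} →
          LineComplex N₁ P ≅ LineComplex N₂ Q → LineComplex N₂ Q ≅ LineComplex N₃ R →
          LineComplex N₁ P ≅ LineComplex N₃ R
≅-trans {P = P} {Q} {R} i j = record
  { to = λ x → J.to (I.to x)
  ; from = λ y → I.from (J.from y)
  ; to-resp = λ x y r → J.to-resp _ _ (I.to-resp x y r)
  ; from-resp = λ x y r → I.from-resp _ _ (J.from-resp x y r)
  ; to-face = λ xs p → subst R (sym (ListP.map-∘ xs)) (J.to-face _ (I.to-face xs p))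
  ; from-face = λ ys p → subst P (sym (ListP.map-∘ ys)) (I.from-face _ (J.from-face ys p))
  ; from-to = λ x fx →
      ≈ₗ-trans (I.from-resp _ _ (J.from-to (I.to x) (I.to-face (x ∷ []) fx))) (I.from-to x fx)
  ; to-from = λ y fy →
      ≈ₗ-trans (J.to-resp _ _ (I.to-from (J.from y) (J.from-face (y ∷ []) fy))) (J.to-from y fy)
  }
  where
  module I = _≅_ i
  module J = _≅_ j

≅-sameFaces : ∀ {N} {P Q : List (Vec ℤ N) → Set₁} →
              (∀ xs → P xs → Q xs) → (∀ xs → Q xs → P xs) → LineComplex N P ≅ LineComplex N Q
≅-sameFaces {P = P} {Q} pq qp = record
  { to = id ; from = id
  ; to-resp = λ _ _ r → r ; from-resp = λ _ _ r → r
  ; to-face = λ xs p → subst Q (sym (ListP.map-id xs)) (pq xs p)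
  ; from-face = λ xs p → subst P (sym (ListP.map-id xs)) (qp xs p)
  ; from-to = λ _ _ → inj₁ refl ; to-from = λ _ _ → inj₁ refl }

-- Faces of links are read off from partial frames: disjointness of the vertex sets
-- is automatic, by independence.

linkFace : ∀ {N} (τ L : List (Vec ℤ N)) → PartialFrame (τ ++ L) → IsFace (Link (𝓑 N) L) τ
linkFace τ L pf = independent⇒disjoint τ L (proj₁ pf) , pf

linkLinkFace : ∀ {N} (τ σ L : List (Vec ℤ N)) → PartialFrame ((τ ++ σ) ++ L) →
               IsFace (Link (Link (𝓑 N) L) σ) τ
linkLinkFace τ σ L pf =
  All.map (λ apart meets → apart (AnyP.++⁺ˡ meets))
          (independent⇒disjoint τ (σ ++ L) (subst Independent (ListP.++-assoc τ σ L) (proj₁ pf))) ,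
  linkFace (τ ++ σ) L pf

link-↭ : ∀ {N} {L L′ : List (Vec ℤ N)} → L ↭ L′ → Link (𝓑 N) L ≅ Link (𝓑 N) L′
link-↭ {L = L} {L′} p =
  ≅-sameFaces (λ τ face → linkFace τ L′ (PartialFrame-↭ (↭P.++⁺ˡ τ p) (proj₂ face)))
              (λ τ face → linkFace τ L (PartialFrame-↭ (↭P.++⁺ˡ τ (↭-sym p)) (proj₂ face)))

linkLink-↭ : ∀ {N} {L L′ : List (Vec ℤ N)} σ → L ↭ L′ →
             Link (Link (𝓑 N) L) σ ≅ Link (Link (𝓑 N) L′) σ
linkLink-↭ {L = L} {L′} σ p =
  ≅-sameFaces (λ τ face → linkLinkFace τ σ L′ (PartialFrame-↭ (↭P.++⁺ˡ (τ ++ σ) p) (proj₂ (proj₂ face))))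
              (λ τ face → linkLinkFace τ σ L (PartialFrame-↭ (↭P.++⁺ˡ (τ ++ σ) (↭-sym p)) (proj₂ (proj₂ face))))

-- If an automorphism A fixes the frame L and sends v to ev, then
-- τ ∪ (v ∷ σ) ∪ L is a partial frame iff A τ ∪ A σ ∪ (ev ∷ L) is one: A moves the
-- vertex v of the simplex into the frame.

move-into-frame : ∀ {A : Set} (X : List A) y Y Z → (X ++ y ∷ Y) ++ Z ↭ (X ++ Y) ++ (y ∷ Z)
move-into-frame X y Y Z =
  ↭.trans (↭.↭-reflexive (ListP.++-assoc X (y ∷ Y) Z))
  (↭.trans (↭P.++⁺ˡ X (↭-sym (↭P.shift y Y Z))) (↭.↭-reflexive (sym (ListP.++-assoc X Y (y ∷ Z)))))

module Transport {N : ℕ} (A : LinAut N) (L : List (Vec ℤ N)) {v ev : Vec ℤ N} (σ : List (Vec ℤ N))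
                 (Av≡ev : LinAut.f A v ≡ ev) (AL≡L : map (LinAut.f A) L ≡ L) where
  open LinAut A

  f⁻¹ev≡v : f⁻¹ ev ≡ v
  f⁻¹ev≡v = trans (cong f⁻¹ (sym Av≡ev)) (f⁻¹∘f v)

  f⁻¹L≡L : map f⁻¹ L ≡ L
  f⁻¹L≡L = trans (cong (map f⁻¹) (sym AL≡L)) (f⁻¹∘f-list L)

  forward : ∀ τ → PartialFrame ((τ ++ v ∷ σ) ++ L) →
            PartialFrame ((map f τ ++ map f σ) ++ (ev ∷ L))
  forward τ pf = PartialFrame-↭ (move-into-frame (map f τ) ev (map f σ) L)
                                (subst PartialFrame image (PartialFrame-map A _ pf))
    where
    image : map f ((τ ++ v ∷ σ) ++ L) ≡ (map f τ ++ ev ∷ map f σ) ++ L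
    image = trans (ListP.map-++ f (τ ++ v ∷ σ) L)
      (cong₂ _++_ (trans (ListP.map-++ f τ (v ∷ σ)) (cong (λ z → map f τ ++ z ∷ map f σ) Av≡ev)) AL≡L)

  backward : ∀ τ → PartialFrame ((τ ++ map f σ) ++ (ev ∷ L)) →
             PartialFrame ((map f⁻¹ τ ++ v ∷ σ) ++ L)
  backward τ pf = PartialFrame-↭ (↭-sym (move-into-frame (map f⁻¹ τ) v σ L))
                                 (subst PartialFrame image (PartialFrame-map (A ⁻¹ᴬ) _ pf))
    where
    image : map f⁻¹ ((τ ++ map f σ) ++ (ev ∷ L)) ≡ (map f⁻¹ τ ++ σ) ++ (v ∷ L)
    image = trans (ListP.map-++ f⁻¹ (τ ++ map f σ) (ev ∷ L))
      (cong₂ _++_ (trans (ListP.map-++ f⁻¹ τ (map f σ)) (cong (map f⁻¹ τ ++_) (f⁻¹∘f-list σ)))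
                  (cong₂ _∷_ f⁻¹ev≡v f⁻¹L≡L))

  iso : Link (Link (𝓑 N) L) (v ∷ σ) ≅ Link (Link (𝓑 N) (ev ∷ L)) (map f σ)
  iso = record
    { to = f ; from = f⁻¹
    ; to-resp = λ _ _ → IsLinear.preserves-≈ₗ f-linear
    ; from-resp = λ _ _ → IsLinear.preserves-≈ₗ f⁻¹-linear
    ; to-face = λ τ face → linkLinkFace (map f τ) (map f σ) (ev ∷ L) (forward τ (proj₂ (proj₂ face)))
    ; from-face = λ τ face → linkLinkFace (map f⁻¹ τ) (v ∷ σ) L (backward τ (proj₂ (proj₂ face)))
    ; from-to = λ x _ → inj₁ (f⁻¹∘f x)
    ; to-from = λ y _ → inj₁ (f∘f⁻¹ y) }

  remainingFace : PartialFrame ((v ∷ σ) ++ L) → IsFace (Link (𝓑 N) (ev ∷ L)) (map f σ)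
  remainingFace pf = linkFace (map f σ) (ev ∷ L) (forward [] pf)

if-holds : ∀ {P : Set} (D : Dec P) {a b : ℤ} → P → (if does D then a else b) ≡ a
if-holds D {a} {b} p = cong (λ t → if t then a else b) (dec-true D p)

if-fails : ∀ {P : Set} (D : Dec P) {a b : ℤ} → ¬ P → (if does D then a else b) ≡ b
if-fails D {a} {b} ¬p = cong (λ t → if t then a else b) (dec-false D ¬p)

record IsLinearForm {N : ℕ} (φ : Vec ℤ N → ℤ) : Set where
  field
    additive    : ∀ x y → φ (x +ᵥ y) ≡ φ x + φ y
    homogeneous : ∀ c x → φ (c ·ᵥ x) ≡ c * φ x

module _ {N : ℕ} where
  open IsLinearForm

  coordinate-linear : (l : Fin N) → IsLinearForm (λ x → lookup x l)
  coordinate-linear l = record { additive = λ x y → lookup-+ᵥ x y l ; homogeneous = λ c x → lookup-·ᵥ c x l }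

  scaled-linear : ∀ α {φ : Vec ℤ N → ℤ} → IsLinearForm φ → IsLinearForm (λ x → α * φ x)
  scaled-linear α Φ = record
    { additive = λ x y → trans (cong (α *_) (additive Φ x y)) (ℤP.*-distribˡ-+ α _ _)
    ; homogeneous = λ c x → trans (cong (α *_) (homogeneous Φ c x)) (swap-scalars α c _) }
    where
    swap-scalars : ∀ α c a → α * (c * a) ≡ c * (α * a)
    swap-scalars = solve-∀

  sum-linear : ∀ {φ ψ : Vec ℤ N → ℤ} → IsLinearForm φ → IsLinearForm ψ → IsLinearForm (λ x → φ x + ψ x)
  sum-linear {φ} {ψ} Φ Ψ = record
    { additive = λ x y → trans (cong₂ _+_ (additive Φ x y) (additive Ψ x y)) (interchange (φ x) (φ y) (ψ x) (ψ y))
    ; homogeneous = λ c x → trans (cong₂ _+_ (homogeneous Φ c x) (homogeneous Ψ c x))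
                                  (sym (ℤP.*-distribˡ-+ c _ _)) }
    where
    interchange : ∀ a b c d → (a + b) + (c + d) ≡ (a + c) + (b + d)
    interchange = solve-∀

  choice-linear : ∀ {P : Set} (D : Dec P) {φ ψ : Vec ℤ N → ℤ} → IsLinearForm φ → IsLinearForm ψ →
                  IsLinearForm (λ x → if does D then φ x else ψ x)
  choice-linear (yes _) Φ Ψ = Φ
  choice-linear (no _) Φ Ψ = Ψ

  coordinatewise : (Fin N → Vec ℤ N → ℤ) → Vec ℤ N → Vec ℤ N
  coordinatewise φ x = V.tabulate (λ l → φ l x)

  lookup-coordinatewise : ∀ φ x l → lookup (coordinatewise φ x) l ≡ φ l x
  lookup-coordinatewise φ x l = VecP.lookup∘tabulate (λ l → φ l x) l

  coordinatewise-linear : ∀ φ → (∀ l → IsLinearForm (φ l)) → IsLinear (coordinatewise φ)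
  coordinatewise-linear φ Φ = record
    { additive = λ x y → ≡-pointwise λ l →
        trans (lookup-coordinatewise φ (x +ᵥ y) l) (trans (additive (Φ l) x y) (sym
          (trans (lookup-+ᵥ (coordinatewise φ x) (coordinatewise φ y) l) (cong₂ _+_ (lookup-coordinatewise φ x l) (lookup-coordinatewise φ y l)))))
    ; homogeneous = λ c x → ≡-pointwise λ l →
        trans (lookup-coordinatewise φ (c ·ᵥ x) l) (trans (homogeneous (Φ l) c x) (sym
          (trans (lookup-·ᵥ c (coordinatewise φ x) l) (cong (c *_) (lookup-coordinatewise φ x l))))) }

row-times-column : ∀ α β p q r s a b →
  α * (p * a + q * b) + β * (r * a + s * b) ≡ (α * p + β * r) * a + (α * q + β * s) * b
row-times-column = solve-∀

picks-first : ∀ a b → + 1 * a + + 0 * b ≡ a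
picks-first = solve-∀

picks-second : ∀ a b → + 0 * a + + 1 * b ≡ b
picks-second = solve-∀

module TwoCoordinates {N : ℕ} (i j : Fin N) (i≢j : i ≢ j) where

  mix : (p q r s : ℤ) → Fin N → Vec ℤ N → ℤ
  mix p q r s l x =
    if does (l FinP.≟ i) then p * lookup x i + q * lookup x j
    else (if does (l FinP.≟ j) then r * lookup x i + s * lookup x j else lookup x l)

  T : (p q r s : ℤ) → Vec ℤ N → Vec ℤ N
  T p q r s = coordinatewise (mix p q r s)

  T-linear : ∀ p q r s → IsLinear (T p q r s)
  T-linear p q r s = coordinatewise-linear (mix p q r s) λ l →
    choice-linear (l FinP.≟ i) (pair p q)
      (choice-linear (l FinP.≟ j) (pair r s) (coordinate-linear l))
    where
    pair : ∀ α β → IsLinearForm (λ x → α * lookup x i + β * lookup x j)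
    pair α β = sum-linear (scaled-linear α (coordinate-linear i)) (scaled-linear β (coordinate-linear j))

  T-at-i : ∀ p q r s x → lookup (T p q r s x) i ≡ p * lookup x i + q * lookup x j
  T-at-i p q r s x = trans (lookup-coordinatewise (mix p q r s) x i) (if-holds (i FinP.≟ i) refl)

  T-at-j : ∀ p q r s x → lookup (T p q r s x) j ≡ r * lookup x i + s * lookup x j
  T-at-j p q r s x = trans (lookup-coordinatewise (mix p q r s) x j)
    (trans (if-fails (j FinP.≟ i) (λ j≡i → i≢j (sym j≡i))) (if-holds (j FinP.≟ j) refl))

  T-elsewhere : ∀ p q r s x l → l ≢ i → l ≢ j → lookup (T p q r s x) l ≡ lookup x l
  T-elsewhere p q r s x l l≢i l≢j = trans (lookup-coordinatewise (mix p q r s) x l)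
    (trans (if-fails (l FinP.≟ i) l≢i) (if-fails (l FinP.≟ j) l≢j))

  T-fixes : ∀ p q r s x → lookup x i ≡ + 0 → lookup x j ≡ + 0 → T p q r s x ≡ x
  T-fixes p q r s x xi≡0 xj≡0 = ≡-pointwise at
    where
    vanishes : ∀ α β → α * lookup x i + β * lookup x j ≡ + 0
    vanishes α β = trans (cong₂ (λ u w → α * u + β * w) xi≡0 xj≡0)
                         (cong₂ _+_ (ℤP.*-zeroʳ α) (ℤP.*-zeroʳ β))
    at : ∀ l → lookup (T p q r s x) l ≡ lookup x l
    at l with l FinP.≟ i | l FinP.≟ j
    ... | yes refl | _ = trans (T-at-i p q r s x) (trans (vanishes p q) (sym xi≡0))
    ... | no _ | yes refl = trans (T-at-j p q r s x) (trans (vanishes r s) (sym xj≡0))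
    ... | no l≢i | no l≢j = T-elsewhere p q r s x l l≢i l≢j

  T-inverse : ∀ p q r s p′ q′ r′ s′ →
              p′ * p + q′ * r ≡ + 1 → p′ * q + q′ * s ≡ + 0 →
              r′ * p + s′ * r ≡ + 0 → r′ * q + s′ * s ≡ + 1 →
              ∀ x → T p′ q′ r′ s′ (T p q r s x) ≡ x
  T-inverse p q r s p′ q′ r′ s′ e₁₁ e₁₂ e₂₁ e₂₂ x = ≡-pointwise at
    where
    a = lookup x i
    b = lookup x j
    inner-i = T-at-i p q r s x
    inner-j = T-at-j p q r s x
    at : ∀ l → lookup (T p′ q′ r′ s′ (T p q r s x)) l ≡ lookup x l
    at l with l FinP.≟ i | l FinP.≟ j
    ... | yes refl | _ = begin
      lookup (T p′ q′ r′ s′ (T p q r s x)) i    ≡⟨ T-at-i p′ q′ r′ s′ (T p q r s x) ⟩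
      p′ * _ + q′ * _                          ≡⟨ cong₂ (λ u w → p′ * u + q′ * w) inner-i inner-j ⟩
      p′ * (p * a + q * b) + q′ * (r * a + s * b) ≡⟨ row-times-column p′ q′ p q r s a b ⟩
      (p′ * p + q′ * r) * a + (p′ * q + q′ * s) * b ≡⟨ cong₂ (λ u w → u * a + w * b) e₁₁ e₁₂ ⟩
      + 1 * a + + 0 * b                        ≡⟨ picks-first a b ⟩
      a                                        ∎
      where open ≡-Reasoning
    ... | no _ | yes refl = begin
      lookup (T p′ q′ r′ s′ (T p q r s x)) j    ≡⟨ T-at-j p′ q′ r′ s′ (T p q r s x) ⟩
      r′ * _ + s′ * _                          ≡⟨ cong₂ (λ u w → r′ * u + s′ * w) inner-i inner-j ⟩
      r′ * (p * a + q * b) + s′ * (r * a + s * b) ≡⟨ row-times-column r′ s′ p q r s a b ⟩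
      (r′ * p + s′ * r) * a + (r′ * q + s′ * s) * b ≡⟨ cong₂ (λ u w → u * a + w * b) e₂₁ e₂₂ ⟩
      + 0 * a + + 1 * b                        ≡⟨ picks-second a b ⟩
      b                                        ∎
      where open ≡-Reasoning
    ... | no l≢i | no l≢j =
      trans (T-elsewhere p′ q′ r′ s′ (T p q r s x) l l≢i l≢j) (T-elsewhere p q r s x l l≢i l≢j)

  bezoutAut : ∀ s t a b → s * a + t * b ≡ + 1 → LinAut N
  bezoutAut s t a b det≡1 = record
    { f = T s t (- b) a ; f⁻¹ = T a (- t) b s
    ; f-linear = T-linear s t (- b) a ; f⁻¹-linear = T-linear a (- t) b s
    ; f⁻¹∘f = T-inverse s t (- b) a a (- t) b s (trans (det₁ s t a b) det≡1) (zero₁ t a) (zero₂ s b) (trans (det₂ s t a b) det≡1)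
    ; f∘f⁻¹ = T-inverse a (- t) b s s t (- b) a det≡1 (zero₃ s t) (zero₄ a b) (trans (det₃ s t a b) det≡1) }
    where
    det₁ : ∀ s t a b → a * s + (- t) * (- b) ≡ s * a + t * b
    det₁ = solve-∀
    det₂ : ∀ s t a b → b * t + s * a ≡ s * a + t * b
    det₂ = solve-∀
    det₃ : ∀ s t a b → (- b) * (- t) + a * s ≡ s * a + t * b
    det₃ = solve-∀
    zero₁ : ∀ t a → a * t + (- t) * a ≡ + 0
    zero₁ = solve-∀
    zero₂ : ∀ s b → b * s + s * (- b) ≡ + 0
    zero₂ = solve-∀
    zero₃ : ∀ s t → s * (- t) + t * s ≡ + 0
    zero₃ = solve-∀
    zero₄ : ∀ a b → (- b) * a + a * b ≡ + 0
    zero₄ = solve-∀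

module ColumnOperation {N : ℕ} (k : Fin N) where

  column : ℤ → (Fin N → ℤ) → Fin N → Vec ℤ N → ℤ
  column d c l x = if does (l FinP.≟ k) then d * lookup x k else lookup x l + c l * lookup x k

  C : ℤ → (Fin N → ℤ) → Vec ℤ N → Vec ℤ N
  C d c = coordinatewise (column d c)

  C-linear : ∀ d c → IsLinear (C d c)
  C-linear d c = coordinatewise-linear (column d c) λ l →
    choice-linear (l FinP.≟ k) (scaled-linear d (coordinate-linear k))
      (sum-linear (coordinate-linear l) (scaled-linear (c l) (coordinate-linear k)))

  C-at-k : ∀ d c x → lookup (C d c x) k ≡ d * lookup x k
  C-at-k d c x = trans (lookup-coordinatewise (column d c) x k) (if-holds (k FinP.≟ k) refl)

  C-elsewhere : ∀ d c x l → l ≢ k → lookup (C d c x) l ≡ lookup x l + c l * lookup x k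
  C-elsewhere d c x l l≢k = trans (lookup-coordinatewise (column d c) x l) (if-fails (l FinP.≟ k) l≢k)

  C-fixes : ∀ d c x → lookup x k ≡ + 0 → C d c x ≡ x
  C-fixes d c x xk≡0 = ≡-pointwise at
    where
    at : ∀ l → lookup (C d c x) l ≡ lookup x l
    at l with l FinP.≟ k
    ... | yes refl = trans (C-at-k d c x) (trans (cong (d *_) xk≡0) (trans (ℤP.*-zeroʳ d) (sym xk≡0)))
    ... | no l≢k = trans (C-elsewhere d c x l l≢k)
      (trans (cong (λ t → lookup x l + c l * t) xk≡0)
             (trans (cong (λ t → lookup x l + t) (ℤP.*-zeroʳ (c l))) (ℤP.+-identityʳ _)))

  C-inverse : ∀ {d c d′ c′} → d′ * d ≡ + 1 → (∀ l → c l + c′ l * d ≡ + 0) →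
              ∀ x → C d′ c′ (C d c x) ≡ x
  C-inverse {d} {c} {d′} {c′} d′d≡1 cancel x = ≡-pointwise at
    where
    a = lookup x k
    regroup : ∀ v cl c′l d a → (v + cl * a) + c′l * (d * a) ≡ v + (cl + c′l * d) * a
    regroup = solve-∀
    at : ∀ l → lookup (C d′ c′ (C d c x)) l ≡ lookup x l
    at l with l FinP.≟ k
    ... | yes refl = begin
      lookup (C d′ c′ (C d c x)) k ≡⟨ C-at-k d′ c′ (C d c x) ⟩
      d′ * lookup (C d c x) k     ≡⟨ cong (d′ *_) (C-at-k d c x) ⟩
      d′ * (d * a)                ≡⟨ sym (ℤP.*-assoc d′ d a) ⟩
      (d′ * d) * a                ≡⟨ cong (_* a) d′d≡1 ⟩
      + 1 * a                     ≡⟨ ℤP.*-identityˡ a ⟩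
      a                           ∎
      where open ≡-Reasoning
    ... | no l≢k = begin
      lookup (C d′ c′ (C d c x)) l
        ≡⟨ C-elsewhere d′ c′ (C d c x) l l≢k ⟩
      lookup (C d c x) l + c′ l * lookup (C d c x) k
        ≡⟨ cong₂ (λ u w → u + c′ l * w) (C-elsewhere d c x l l≢k) (C-at-k d c x) ⟩
      (lookup x l + c l * a) + c′ l * (d * a)
        ≡⟨ regroup (lookup x l) (c l) (c′ l) d a ⟩
      lookup x l + (c l + c′ l * d) * a
        ≡⟨ cong (λ t → lookup x l + t * a) (cancel l) ⟩
      lookup x l + + 0 * a
        ≡⟨ ℤP.+-identityʳ _ ⟩
      lookup x l ∎
      where open ≡-Reasoning

  columnAut : ∀ d (c : Fin N → ℤ) → d * d ≡ + 1 → LinAut N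
  columnAut d c dd≡1 = record
    { f = C d c ; f⁻¹ = C d c′
    ; f-linear = C-linear d c ; f⁻¹-linear = C-linear d c′
    ; f⁻¹∘f = C-inverse {d} {c} {d} {c′} dd≡1 (λ l → cancels (c l))
    ; f∘f⁻¹ = C-inverse {d} {c′} {d} {c} dd≡1 (λ l → ℤP.+-inverseˡ (c l * d)) }
    where
    c′ : Fin N → ℤ
    c′ l = - (c l * d)
    expand : ∀ a d → a + - (a * d) * d ≡ a - a * (d * d)
    expand = solve-∀
    cancels : ∀ a → a + - (a * d) * d ≡ + 0
    cancels a = trans (expand a d) (trans (cong (λ t → a - a * t) dd≡1)
                  (trans (cong (λ t → a - t) (ℤP.*-identityʳ a)) (ℤP.+-inverseʳ a)))

signum : ℤ → ℤ
signum (+ _) = + 1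
signum -[1+ _ ] = ℤ.-1ℤ

signum-abs : ∀ a → signum a * a ≡ + ∣ a ∣
signum-abs (+ n) = ℤP.*-identityˡ (+ n)
signum-abs -[1+ n ] = ℤP.-1*i≡-i -[1+ n ]

signum-squared : ∀ a → signum a * signum a ≡ + 1
signum-squared (+ _) = refl
signum-squared -[1+ _ ] = refl

record IntegerBezout (a b : ℤ) : Set where
  field
    g          : ℕ
    s t a′ b′  : ℤ
    identity   : s * a + t * b ≡ + g
    a≡a′g      : a ≡ a′ * + g
    b≡b′g      : b ≡ b′ * + g

signed-quotient : ∀ a q d → ∣ a ∣ ≡ q ℕ.* d → a ≡ (signum a * + q) * + d
signed-quotient a q d eq = begin
  a                         ≡⟨ sym (ℤP.*-identityˡ a) ⟩
  + 1 * a                   ≡⟨ cong (_* a) (sym (signum-squared a)) ⟩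
  (signum a * signum a) * a ≡⟨ ℤP.*-assoc (signum a) (signum a) a ⟩
  signum a * (signum a * a) ≡⟨ cong (signum a *_) (signum-abs a) ⟩
  signum a * + ∣ a ∣        ≡⟨ cong (λ z → signum a * + z) eq ⟩
  signum a * + (q ℕ.* d)    ≡⟨ cong (signum a *_) (ℤP.pos-* q d) ⟩
  signum a * (+ q * + d)    ≡⟨ sym (ℤP.*-assoc (signum a) (+ q) (+ d)) ⟩
  (signum a * + q) * + d    ∎
  where open ≡-Reasoning

natural-identity : ∀ g x y A B → g ℕ.+ y ℕ.* B ≡ x ℕ.* A → + x * + A - + y * + B ≡ + g
natural-identity g x y A B eq = begin
  + x * + A - + y * + B          ≡⟨ cong₂ _-_ (sym (ℤP.pos-* x A)) (sym (ℤP.pos-* y B)) ⟩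
  + (x ℕ.* A) - + (y ℕ.* B)      ≡⟨ cong (λ z → + z - + (y ℕ.* B)) (sym eq) ⟩
  + (g ℕ.+ y ℕ.* B) - + (y ℕ.* B) ≡⟨ cong (_- + (y ℕ.* B)) (ℤP.pos-+ g (y ℕ.* B)) ⟩
  (+ g + + (y ℕ.* B)) - + (y ℕ.* B) ≡⟨ cancel (+ g) (+ (y ℕ.* B)) ⟩
  + g                             ∎
  where
  open ≡-Reasoning
  cancel : ∀ u v → (u + v) - v ≡ u
  cancel = solve-∀

integer-bezout : ∀ a b → IntegerBezout a b
integer-bezout a b with Bézout.lemma ∣ a ∣ ∣ b ∣
... | Bézout.result g isGCD bezout with GCD.gcd∣m isGCD | GCD.gcd∣n isGCD
... | divides qa a≡ | divides qb b≡ = from bezout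
  where
  regroup : ∀ x y σa σb a b → (x * σa) * a + (- (y * σb)) * b ≡ x * (σa * a) - y * (σb * b)
  regroup = solve-∀
  from : Bézout.Identity g ∣ a ∣ ∣ b ∣ → IntegerBezout a b
  from (Bézout.+- x y eq) = record
    { g = g ; s = + x * signum a ; t = - (+ y * signum b)
    ; a′ = signum a * + qa ; b′ = signum b * + qb
    ; identity = trans (regroup (+ x) (+ y) (signum a) (signum b) a b)
        (trans (cong₂ (λ u w → + x * u - + y * w) (signum-abs a) (signum-abs b))
               (natural-identity g x y ∣ a ∣ ∣ b ∣ eq))
    ; a≡a′g = signed-quotient a qa g a≡ ; b≡b′g = signed-quotient b qb g b≡ }
  from (Bézout.-+ x y eq) = record
    { g = g ; s = - (+ x * signum a) ; t = + y * signum b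
    ; a′ = signum a * + qa ; b′ = signum b * + qb
    ; identity = trans (ℤP.+-comm (- (+ x * signum a) * a) (+ y * signum b * b))
        (trans (regroup (+ y) (+ x) (signum b) (signum a) b a)
        (trans (cong₂ (λ u w → + y * u - + x * w) (signum-abs b) (signum-abs a))
               (natural-identity g y x ∣ b ∣ ∣ a ∣ eq)))
    ; a≡a′g = signed-quotient a qa g a≡ ; b≡b′g = signed-quotient b qb g b≡ }

record ClearsCoordinate {N : ℕ} (k j : Fin N) (x : Vec ℤ N) : Set where
  field
    aut   : LinAut N
    fixes : ∀ y → lookup y k ≡ + 0 → lookup y j ≡ + 0 → LinAut.f aut y ≡ y
    kills : lookup (LinAut.f aut x) j ≡ + 0
    keeps : ∀ l → l ≢ k → l ≢ j → lookup (LinAut.f aut x) l ≡ lookup x l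

clear-coordinate : ∀ {N} (k j : Fin N) → j ≢ k → ∀ x → ClearsCoordinate k j x
clear-coordinate k j j≢k x = from (integer-bezout (lookup x k) (lookup x j))
  where
  open TwoCoordinates k j (λ k≡j → j≢k (sym k≡j))
  -- gcd 0: then x_j = 0 already.
  from : IntegerBezout (lookup x k) (lookup x j) → ClearsCoordinate k j x
  from record { g = zero ; b′ = b′ ; b≡b′g = b≡b′g } = record
    { aut = idAut ; fixes = λ _ _ _ → refl ; kills = trans b≡b′g (ℤP.*-zeroʳ b′) ; keeps = λ _ _ _ → refl }
  -- gcd g > 0: (x_k, x_j) = g (a′, b′) with s a′ + t b′ = 1, and [[s,t],[-b′,a′]] sends it to (g, 0).
  from record { g = suc n ; s = s ; t = t ; a′ = a′ ; b′ = b′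
              ; identity = identity ; a≡a′g = a≡a′g ; b≡b′g = b≡b′g } = record
    { aut = bezoutAut s t a′ b′ coprime
    ; fixes = λ y yk≡0 yj≡0 → T-fixes s t (- b′) a′ y yk≡0 yj≡0
    ; kills = trans (T-at-j s t (- b′) a′ x)
                    (trans (cong₂ (λ u w → (- b′) * u + a′ * w) a≡a′g b≡b′g) (cross a′ b′ g))
    ; keeps = T-elsewhere s t (- b′) a′ x }
    where
    g = + suc n
    factor : ∀ s t a′ b′ g → (s * a′ + t * b′) * g ≡ s * (a′ * g) + t * (b′ * g)
    factor = solve-∀
    cross : ∀ a′ b′ g → (- b′) * (a′ * g) + a′ * (b′ * g) ≡ + 0
    cross = solve-∀
    coprime : s * a′ + t * b′ ≡ + 1
    coprime = ℤP.*-cancelʳ-≡ _ _ g (begin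
      (s * a′ + t * b′) * g          ≡⟨ factor s t a′ b′ g ⟩
      s * (a′ * g) + t * (b′ * g)    ≡⟨ cong₂ (λ u w → s * u + t * w) (sym a≡a′g) (sym b≡b′g) ⟩
      s * lookup x k + t * lookup x j ≡⟨ identity ⟩
      g                              ≡⟨ sym (ℤP.*-identityˡ g) ⟩
      + 1 * g                        ∎)
      where open ≡-Reasoning

record ClearsCoordinates {N : ℕ} (k : Fin N) (J : List (Fin N)) (x : Vec ℤ N) : Set where
  field
    aut   : LinAut N
    fixes : ∀ y → lookup y k ≡ + 0 → All (λ j → lookup y j ≡ + 0) J → LinAut.f aut y ≡ y
    kills : All (λ j → lookup (LinAut.f aut x) j ≡ + 0) J

clear-coordinates : ∀ {N} (k : Fin N) (J : List (Fin N)) → All (_≢ k) J → ∀ x → ClearsCoordinates k J x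
clear-coordinates k [] _ x = record { aut = idAut ; fixes = λ _ _ _ → refl ; kills = [] }
clear-coordinates k (j ∷ J) (j≢k ∷ J≢k) x = record
  { aut = Aⱼ ∘ᴬ A
  ; fixes = λ { y yk≡0 (yj≡0 ∷ yJ≡0) →
      trans (cong (LinAut.f Aⱼ) (fixes y yk≡0 yJ≡0)) (step.fixes y yk≡0 yj≡0) }
  ; kills = step.kills ∷ still-cleared J J≢k kills }
  where
  open ClearsCoordinates (clear-coordinates k J J≢k x)
  module step = ClearsCoordinate (clear-coordinate k j j≢k (LinAut.f aut x))
  A = aut
  Aⱼ = step.aut
  still-cleared : ∀ K → All (_≢ k) K → All (λ l → lookup (LinAut.f A x) l ≡ + 0) K →
                  All (λ l → lookup (LinAut.f Aⱼ (LinAut.f A x)) l ≡ + 0) K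
  still-cleared [] _ _ = []
  still-cleared (l ∷ K) (l≢k ∷ K≢k) (zero-l ∷ zeros) with l FinP.≟ j
  ... | yes refl = step.kills ∷ still-cleared K K≢k zeros
  ... | no l≢j = trans (step.keeps l l≢k l≢j) zero-l ∷ still-cleared K K≢k zeros

unit-squared : ∀ d c → d * c ≡ + 1 → d * d ≡ + 1
unit-squared (+ n) c eq with ℕP.m*n≡1⇒m≡1 n ∣ c ∣ (trans (sym (ℤP.abs-* (+ n) c)) (cong ∣_∣ eq))
... | refl = refl
unit-squared -[1+ n ] c eq
  with ℕP.m*n≡1⇒m≡1 (suc n) ∣ c ∣ (trans (sym (ℤP.abs-* -[1+ n ] c)) (cong ∣_∣ eq))
... | refl = refl

lookup-affine : ∀ {N} (x : Vec ℤ N) c y i → lookup (x +ᵥ (c ·ᵥ y)) i ≡ lookup x i + c * lookup y i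
lookup-affine x c y i = trans (lookup-+ᵥ x (c ·ᵥ y) i) (cong (λ t → lookup x i + t) (lookup-·ᵥ c y i))

-- With r = w - d u and u = a + b:  d b = (w - r) - d a.
scaled-remainder : ∀ {N} (w u a b : Vec ℤ N) d → u ≡ (a +ᵥ b) →
                   (d ·ᵥ b) ≡ ((w +ᵥ (ℤ.-1ℤ ·ᵥ (w +ᵥ ((- d) ·ᵥ u)))) +ᵥ ((- d) ·ᵥ a))
scaled-remainder w u a b d u≡a+b = ≡-pointwise λ i → begin
  lookup (d ·ᵥ b) i
    ≡⟨ lookup-·ᵥ d b i ⟩
  d * lookup b i
    ≡⟨ expand d (lookup w i) (lookup a i) (lookup b i) ⟩
  (lookup w i + ℤ.-1ℤ * (lookup w i + (- d) * (lookup a i + lookup b i))) + (- d) * lookup a i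
    ≡⟨ cong (λ t → (lookup w i + ℤ.-1ℤ * (lookup w i + (- d) * t)) + (- d) * lookup a i)
            (sym (trans (cong (λ z → lookup z i) u≡a+b) (lookup-+ᵥ a b i))) ⟩
  (lookup w i + ℤ.-1ℤ * (lookup w i + (- d) * lookup u i)) + (- d) * lookup a i
    ≡⟨ cong (λ t → (lookup w i + ℤ.-1ℤ * t) + (- d) * lookup a i) (sym (lookup-affine w (- d) u i)) ⟩
  (lookup w i + ℤ.-1ℤ * lookup r i) + (- d) * lookup a i
    ≡⟨ cong (_+ (- d) * lookup a i) (sym (lookup-affine w ℤ.-1ℤ r i)) ⟩
  lookup (w +ᵥ (ℤ.-1ℤ ·ᵥ r)) i + (- d) * lookup a i
    ≡⟨ sym (lookup-affine (w +ᵥ (ℤ.-1ℤ ·ᵥ r)) (- d) a i) ⟩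
  lookup ((w +ᵥ (ℤ.-1ℤ ·ᵥ r)) +ᵥ ((- d) ·ᵥ a)) i ∎
  where
  open ≡-Reasoning
  r = w +ᵥ ((- d) ·ᵥ u)
  expand : ∀ d w a b → d * b ≡ (w + ℤ.-1ℤ * (w + (- d) * (a + b))) + (- d) * a
  expand = solve-∀

-- Let w ∷ R be a partial frame and w - d u ∈ ⟨R⟩ with d ≠ 0.  Write u = a + b with a in
-- the summand and b in its complement: d b = (w - (w - d u)) - d a lies in both, so
-- d b = 0, hence b = 0 and u = a lies in the summand.
in-summand : ∀ {N} (w u : Vec ℤ N) R d → PartialFrame (w ∷ R) →
             Span R (w +ᵥ ((- d) ·ᵥ u)) → d ≢ + 0 → Span (w ∷ R) u
in-summand {N} w u R d (_ , B , disjoint , covers) rest d≢0 with covers u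
... | a , b , a∈ , b∈B , u≡a+b = subst (Span (w ∷ R)) a≡u a∈
  where
  db-in-summand : Span (w ∷ R) (d ·ᵥ b)
  db-in-summand = subst (Span (w ∷ R)) (sym (scaled-remainder w u a b d u≡a+b))
    (span-+ _ (span-+ _ (span-head w R) (span-· _ ℤ.-1ℤ (span-tail w R rest))) (span-· _ (- d) a∈))
  db≡0 : (d ·ᵥ b) ≡ 0ᵥ N
  db≡0 = disjoint _ db-in-summand (subgroup-· B d b b∈B)
  b-coordinate : ∀ i → lookup b i ≡ + 0
  b-coordinate i with ℤP.i*j≡0⇒i≡0∨j≡0 d
      (trans (sym (lookup-·ᵥ d b i)) (trans (cong (λ z → lookup z i) db≡0) (lookup-0ᵥ N i)))
  ... | inj₁ d≡0 = ⊥-elim (d≢0 d≡0)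
  ... | inj₂ bi≡0 = bi≡0
  a≡u : a ≡ u
  a≡u = sym (trans u≡a+b (trans (cong (a +ᵥ_) (≡-pointwise λ i → trans (b-coordinate i) (sym (lookup-0ᵥ N i))))
                                (+ᵥ-identityʳ a)))

-- If w ∷ R is a partial frame and w - d u ∈ ⟨R⟩, then d = ±1.  (d = 0 would put w in
-- ⟨R⟩; otherwise u = c₀ w + r with r ∈ ⟨R⟩, so (1 - d c₀) w ∈ ⟨R⟩ and d c₀ = 1.)
unit-coefficient : ∀ {N} (w u : Vec ℤ N) R d → PartialFrame (w ∷ R) →
                   Span R (w +ᵥ ((- d) ·ᵥ u)) → d * d ≡ + 1
unit-coefficient w u R d frame rest with d ℤ.≟ + 0
... | yes refl = ⊥-elim (one≢zero (head-coefficient-zero w R (proj₁ frame) (+ 1) (subst (Span R) w-only rest)))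
  where
  one≢zero : + 1 ≢ + 0
  one≢zero ()
  w-only : (w +ᵥ ((+ 0) ·ᵥ u)) ≡ ((+ 1) ·ᵥ w)
  w-only = trans (cong (w +ᵥ_) (·ᵥ-zeroˡ u)) (trans (+ᵥ-identityʳ w) (sym (·ᵥ-identityˡ w)))
... | no d≢0 with in-summand w u R d frame rest d≢0
...   | c₀ ∷ cs , l , c₀w+r≡u = unit-squared d c₀ dc₀≡1
  where
  r = lincomb cs R
  rearrange : ∀ d c₀ w r → (+ 1 - d * c₀) * w ≡ (w + (- d) * (c₀ * w + r)) + d * r
  rearrange = solve-∀
  u-coordinate : ∀ i → lookup u i ≡ c₀ * lookup w i + lookup r i
  u-coordinate i = trans (cong (λ z → lookup z i) (sym c₀w+r≡u))
    (trans (lookup-+ᵥ (c₀ ·ᵥ w) r i) (cong (_+ lookup r i) (lookup-·ᵥ c₀ w i)))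
  multiple-of-w : ((+ 1 - d * c₀) ·ᵥ w) ≡ ((w +ᵥ ((- d) ·ᵥ u)) +ᵥ (d ·ᵥ r))
  multiple-of-w = ≡-pointwise λ i → begin
    lookup ((+ 1 - d * c₀) ·ᵥ w) i                     ≡⟨ lookup-·ᵥ (+ 1 - d * c₀) w i ⟩
    (+ 1 - d * c₀) * lookup w i                        ≡⟨ rearrange d c₀ (lookup w i) (lookup r i) ⟩
    (lookup w i + (- d) * (c₀ * lookup w i + lookup r i)) + d * lookup r i
      ≡⟨ cong (λ t → (lookup w i + (- d) * t) + d * lookup r i) (sym (u-coordinate i)) ⟩
    (lookup w i + (- d) * lookup u i) + d * lookup r i
      ≡⟨ cong (_+ d * lookup r i) (sym (lookup-affine w (- d) u i)) ⟩
    lookup (w +ᵥ ((- d) ·ᵥ u)) i + d * lookup r i      ≡⟨ sym (lookup-affine (w +ᵥ ((- d) ·ᵥ u)) d r i) ⟩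
    lookup ((w +ᵥ ((- d) ·ᵥ u)) +ᵥ (d ·ᵥ r)) i         ∎
    where open ≡-Reasoning
  one-minus-dc₀≡0 : + 1 - d * c₀ ≡ + 0
  one-minus-dc₀≡0 = head-coefficient-zero w R (proj₁ frame) (+ 1 - d * c₀)
    (subst (Span R) (sym multiple-of-w) (span-+ R rest (span-· R d (cs , ℕP.suc-injective l , refl))))
  solve-for : ∀ x → x ≡ + 1 - (+ 1 - x)
  solve-for = solve-∀
  dc₀≡1 : d * c₀ ≡ + 1
  dc₀≡1 = trans (solve-for (d * c₀)) (cong (λ t → + 1 - t) one-minus-dc₀≡0)

-- Coordinates are indexed from 0, and e_k is written eℕ N k so
-- that k may be any natural number.

eℕ : (N k : ℕ) → Vec ℤ N
eℕ N k = V.tabulate λ l → if does (toℕ l ℕ.≟ k) then + 1 else + 0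

lookup-eℕ-on : ∀ {N} k (l : Fin N) → toℕ l ≡ k → lookup (eℕ N k) l ≡ + 1
lookup-eℕ-on k l l≡k = trans (VecP.lookup∘tabulate _ l) (if-holds (toℕ l ℕ.≟ k) l≡k)

lookup-eℕ-off : ∀ {N} k (l : Fin N) → toℕ l ≢ k → lookup (eℕ N k) l ≡ + 0
lookup-eℕ-off k l l≢k = trans (VecP.lookup∘tabulate _ l) (if-fails (toℕ l ℕ.≟ k) l≢k)

eℕ≡e : ∀ N (i : Fin N) → eℕ N (toℕ i) ≡ e N i
eℕ≡e N i = ≡-pointwise λ l →
  trans (VecP.lookup∘tabulate _ l)
        (trans (cong (λ t → if t then + 1 else + 0) (same-test l)) (sym (VecP.lookup∘tabulate _ l)))
  where
  same-test : ∀ l → does (toℕ l ℕ.≟ toℕ i) ≡ does (i FinP.≟ l)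
  same-test l with i FinP.≟ l
  ... | yes refl = dec-true (toℕ i ℕ.≟ toℕ i) refl
  ... | no i≢l = dec-false (toℕ l ℕ.≟ toℕ i) (λ eq → i≢l (sym (FinP.toℕ-injective eq)))

-- E_m, listed as e_{m-1}, …, e_0.
stdFrame : (N m : ℕ) → List (Vec ℤ N)
stdFrame N m = L.applyDownFrom (eℕ N) m

SupportedBelow : ∀ {N} → ℕ → Vec ℤ N → Set
SupportedBelow m y = ∀ l → m ℕ.≤ toℕ l → lookup y l ≡ + 0

stdFrame-supported : ∀ {N} m → All (SupportedBelow m) (stdFrame N m)
stdFrame-supported zero = []
stdFrame-supported (suc m) =
  (λ l m<l → lookup-eℕ-off m l (λ l≡m → ℕP.<-irrefl (sym l≡m) m<l)) ∷
  All.map (λ supp l m+1≤l → supp l (ℕP.≤-trans (ℕP.n≤1+n m) m+1≤l)) (stdFrame-supported m)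

fixes-stdFrame : ∀ {N} m (h : Vec ℤ N → Vec ℤ N) → (∀ y → SupportedBelow m y → h y ≡ y) →
                 map h (stdFrame N m) ≡ stdFrame N m
fixes-stdFrame m h fixes = ListP.map-id-local (All.map (λ {y} supp → fixes y supp) (stdFrame-supported m))

drop-top : ∀ {N} m (x : Vec ℤ N) c → (∀ l → toℕ l ≡ m → lookup x l ≡ c) →
           SupportedBelow (suc m) x → SupportedBelow m (x +ᵥ ((- c) ·ᵥ eℕ N m))
drop-top {N} m x c top supp l m≤l with toℕ l ℕ.≟ m
... | yes l≡m = trans (lookup-affine x (- c) (eℕ N m) l)
  (trans (cong₂ (λ u v → u + (- c) * v) (top l l≡m) (lookup-eℕ-on m l l≡m)) (cancel c))
  where
  cancel : ∀ c → c + (- c) * + 1 ≡ + 0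
  cancel = solve-∀
... | no l≢m = trans (lookup-affine x (- c) (eℕ N m) l)
  (trans (cong₂ (λ u v → u + (- c) * v) (supp l (ℕP.≤∧≢⇒< m≤l (λ m≡l → l≢m (sym m≡l)))) (lookup-eℕ-off m l l≢m))
         (vanish (- c)))
  where
  vanish : ∀ c → + 0 + c * + 0 ≡ + 0
  vanish = solve-∀

-- The coordinate of x with index k : ℕ (0 when k is out of range).
coordinateℕ : ∀ {N} → Vec ℤ N → ℕ → ℤ
coordinateℕ [] k = + 0
coordinateℕ (a ∷ x) zero = a
coordinateℕ (a ∷ x) (suc k) = coordinateℕ x k

coordinateℕ-toℕ : ∀ {N} (x : Vec ℤ N) l → coordinateℕ x (toℕ l) ≡ lookup x l
coordinateℕ-toℕ (a ∷ x) zero = refl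
coordinateℕ-toℕ (a ∷ x) (suc l) = coordinateℕ-toℕ x l

supported⇒span : ∀ {N} m (x : Vec ℤ N) → SupportedBelow m x → Span (stdFrame N m) x
supported⇒span {N} zero x supp = [] , refl , ≡-pointwise λ l → trans (lookup-0ᵥ N l) (sym (supp l z≤n))
supported⇒span {N} (suc m) x supp = c ∷ cs , cong suc |cs| , trans (cong ((c ·ᵥ eℕ N m) +ᵥ_) cs-spans) restore
  where
  c = coordinateℕ x m
  x′ = x +ᵥ ((- c) ·ᵥ eℕ N m)
  x′-spanned : Span (stdFrame N m) x′
  x′-spanned = supported⇒span m x′
    (drop-top m x c (λ l l≡m → trans (sym (coordinateℕ-toℕ x l)) (cong (coordinateℕ x) l≡m)) supp)
  cs = proj₁ x′-spanned
  |cs| = proj₁ (proj₂ x′-spanned)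
  cs-spans = proj₂ (proj₂ x′-spanned)
  put-back : ∀ c e a → c * e + (a + (- c) * e) ≡ a
  put-back = solve-∀
  restore : ((c ·ᵥ eℕ N m) +ᵥ x′) ≡ x
  restore = ≡-pointwise λ l →
    trans (lookup-+ᵥ (c ·ᵥ eℕ N m) x′ l)
          (trans (cong₂ _+_ (lookup-·ᵥ c (eℕ N m) l) (lookup-affine x (- c) (eℕ N m) l)) (put-back c _ _))

module Reduction {N m : ℕ} (m<N : suc m ℕ.≤ N) where

  k : Fin N
  k = F.fromℕ< m<N

  toℕ-k : toℕ k ≡ m
  toℕ-k = FinP.toℕ-fromℕ< m<N

  index-m⇒k : ∀ l → toℕ l ≡ m → l ≡ k
  index-m⇒k l l≡m = FinP.toℕ-injective (trans l≡m (sym toℕ-k))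

  low⇒vanishes-at-k : ∀ y → SupportedBelow m y → lookup y k ≡ + 0
  low⇒vanishes-at-k y supp = supp k (ℕP.≤-reflexive (sym toℕ-k))

  record FixingBelow (P : Vec ℤ N → Set) (x : Vec ℤ N) : Set where
    field
      aut         : LinAut N
      fixes-below : ∀ y → SupportedBelow m y → LinAut.f aut y ≡ y
      moves-to    : P (LinAut.f aut x)

  clear-above : ∀ v → FixingBelow (SupportedBelow (suc m)) v
  clear-above v = record { aut = aut ; fixes-below = fixes-below ; moves-to = cleared }
    where
    above? : (l : Fin N) → Dec (m ℕ.< toℕ l)
    above? l = m ℕ.<? toℕ l
    J = L.filter above? (L.allFin N)
    J-above : All (λ l → m ℕ.< toℕ l) J
    J-above = AllP.all-filter above? (L.allFin N)
    J≢k : All (_≢ k) J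
    J≢k = All.map (λ m<l l≡k → ℕP.<-irrefl (trans (sym toℕ-k) (cong toℕ (sym l≡k))) m<l) J-above
    open ClearsCoordinates (clear-coordinates k J J≢k v)
    fixes-below : ∀ y → SupportedBelow m y → LinAut.f aut y ≡ y
    fixes-below y supp = fixes y (low⇒vanishes-at-k y supp) (All.map (λ {l} m<l → supp l (ℕP.<⇒≤ m<l)) J-above)
    cleared : SupportedBelow (suc m) (LinAut.f aut v)
    cleared l m<l = All.lookup kills (∈P.∈-filter⁺ above? (∈P.∈-allFin l) m<l)

  -- A vector w supported below m+1 that extends E_m (together with R) to a partial
  -- frame has w_m = ±1, because w - w_m e_m lies in the span of E_m.
  pivot-unit : ∀ w R → SupportedBelow (suc m) w → PartialFrame (w ∷ R ++ stdFrame N m) →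
               lookup w k * lookup w k ≡ + 1
  pivot-unit w R supp frame = unit-coefficient w (eℕ N m) (R ++ stdFrame N m) (lookup w k) frame
    (span-++ʳ R (stdFrame N m) (supported⇒span m _
      (drop-top m w (lookup w k) (λ l l≡m → cong (lookup w) (index-m⇒k l l≡m)) supp)))

  normalize : ∀ w → lookup w k * lookup w k ≡ + 1 → FixingBelow (_≡ eℕ N m) w
  normalize w dd≡1 = record
    { aut = columnAut d c dd≡1
    ; fixes-below = λ y supp → C-fixes d c y (low⇒vanishes-at-k y supp)
    ; moves-to = ≡-pointwise at }
    where
    open ColumnOperation k
    d = lookup w k
    c : Fin N → ℤ
    c l = - (d * lookup w l)
    expand : ∀ d x → x + - (d * x) * d ≡ x - x * (d * d)
    expand = solve-∀
    at : ∀ l → lookup (C d c w) l ≡ lookup (eℕ N m) l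
    at l with l FinP.≟ k
    ... | yes refl = trans (C-at-k d c w) (trans dd≡1 (sym (lookup-eℕ-on m k toℕ-k)))
    ... | no l≢k = begin
      lookup (C d c w) l                ≡⟨ C-elsewhere d c w l l≢k ⟩
      lookup w l + c l * d              ≡⟨ expand d (lookup w l) ⟩
      lookup w l - lookup w l * (d * d) ≡⟨ cong (λ t → lookup w l - lookup w l * t) dd≡1 ⟩
      lookup w l - lookup w l * + 1     ≡⟨ cong (λ t → lookup w l - t) (ℤP.*-identityʳ _) ⟩
      lookup w l - lookup w l           ≡⟨ ℤP.+-inverseʳ (lookup w l) ⟩
      + 0                               ≡⟨ sym (lookup-eℕ-off m l (λ l≡m → l≢k (index-m⇒k l l≡m))) ⟩
      lookup (eℕ N m) l                 ∎
      where open ≡-Reasoning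

  reduce : ∀ v S → PartialFrame ((v ∷ S) ++ stdFrame N m) → FixingBelow (_≡ eℕ N m) v
  reduce v S frame = record
    { aut = A₂.aut ∘ᴬ A₁.aut
    ; fixes-below = λ y supp → trans (cong (LinAut.f A₂.aut) (A₁.fixes-below y supp)) (A₂.fixes-below y supp)
    ; moves-to = A₂.moves-to }
    where
    module A₁ = FixingBelow (clear-above v)
    f₁ = LinAut.f A₁.aut
    w = f₁ v
    frame₁ : PartialFrame (w ∷ map f₁ S ++ stdFrame N m)
    frame₁ = subst PartialFrame
      (trans (ListP.map-++ f₁ (v ∷ S) (stdFrame N m))
             (cong ((w ∷ map f₁ S) ++_) (fixes-stdFrame m f₁ A₁.fixes-below)))
      (PartialFrame-map A₁.aut _ frame)
    module A₂ = FixingBelow (normalize w (pivot-unit w (map f₁ S) A₁.moves-to frame₁))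

link-of-frame-link : ∀ {N} K m (σ : List (Vec ℤ N)) → length σ ≡ K → K ℕ.+ m ℕ.≤ N →
                     IsFace (Link (𝓑 N) (stdFrame N m)) σ →
                     Link (Link (𝓑 N) (stdFrame N m)) σ ≅ Link (𝓑 N) (stdFrame N (K ℕ.+ m))
link-of-frame-link zero m (_ ∷ _) () _ _
link-of-frame-link (suc K) m [] () _ _
link-of-frame-link {N} zero m [] _ _ _ =
  ≅-sameFaces (λ τ face → linkFace τ E (subst (λ t → PartialFrame (t ++ E)) (ListP.++-identityʳ τ) (proj₂ (proj₂ face))))
              (λ τ face → linkLinkFace τ [] E (subst (λ t → PartialFrame (t ++ E)) (sym (ListP.++-identityʳ τ)) (proj₂ face)))
  where E = stdFrame N m
link-of-frame-link {N} (suc K) m (v ∷ σ) |σ| bound face =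
  ≅-trans (Transport.iso A E σ A.moves-to fixes-E)
          (subst (λ M → Link (Link (𝓑 N) (stdFrame N (suc m))) (map f σ) ≅ Link (𝓑 N) (stdFrame N M))
                 (ℕP.+-suc K m)
                 (link-of-frame-link K (suc m) (map f σ) (trans (ListP.length-map f σ) (ℕP.suc-injective |σ|))
                                     (subst (ℕ._≤ N) (sym (ℕP.+-suc K m)) bound)
                                     (Transport.remainingFace A E σ A.moves-to fixes-E (proj₂ face))))
  where
  E = stdFrame N m
  m<N : suc m ℕ.≤ N
  m<N = ℕP.≤-trans (s≤s (ℕP.m≤n+m m K)) bound
  module A = Reduction.FixingBelow (Reduction.reduce m<N v σ (proj₂ face))
  A = A.aut
  f = LinAut.f A
  fixes-E : map f E ≡ E
  fixes-E = fixes-stdFrame m f A.fixes-below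

tabulate-toℕ : ∀ {A : Set} M (h : ℕ → A) → L.tabulate {n = M} (λ i → h (toℕ i)) ≡ L.applyUpTo h M
tabulate-toℕ zero h = refl
tabulate-toℕ (suc M) h = cong (h 0 ∷_) (tabulate-toℕ M (λ k → h (suc k)))

Eframe↭stdFrame : ∀ m n → Eframe m n ↭ stdFrame (m ℕ.+ n) m
Eframe↭stdFrame m n = ↭.trans (↭.↭-reflexive increasing) up↭down
  where
  N = m ℕ.+ n
  increasing : Eframe m n ≡ L.applyUpTo (eℕ N) m
  increasing = trans (ListP.map-tabulate id (λ i → e N (i F.↑ˡ n)))
    (trans (ListP.tabulate-cong (λ i → trans (sym (eℕ≡e N (i F.↑ˡ n))) (cong (eℕ N) (FinP.toℕ-↑ˡ i n))))
           (tabulate-toℕ m (eℕ N)))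
  up↭down : L.applyUpTo (eℕ N) m ↭ L.applyDownFrom (eℕ N) m
  up↭down = ↭-sym (subst (_↭ L.applyUpTo (eℕ N) m) (ListP.reverse-applyUpTo (eℕ N) m)
                         (↭P.↭-reverse (L.applyUpTo (eℕ N) m)))

link-cast : ∀ {N N′ M M′} → N ≡ N′ → M ≡ M′ → Link (𝓑 N) (stdFrame N M) ≅ Link (𝓑 N′) (stdFrame N′ M′)
link-cast refl refl = ≅-sameFaces (λ _ face → face) (λ _ face → face)

-- Lemma 4.3.  𝓑ⁿ_m is the link of the standard frame; reorder that frame as E_m, move the
-- k vertices of σ into it, and identify ℤ^{m+n} with ℤ^{(m+k)+(n-k)}.
lemma4p3 : (n m k : ℕ) → 1 ℕ.≤ k → k ℕ.≤ n →
    (σ : List (V 𝓑[ n , m ])) → length σ ≡ k → IsFace 𝓑[ n , m ] σ →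
    Link 𝓑[ n , m ] σ ≅ 𝓑[ n ℕ.∸ k , m ℕ.+ k ]
lemma4p3 n m k _ k≤n σ |σ|≡k face =
  ≅-trans (linkLink-↭ σ (Eframe↭stdFrame m n))
  (≅-trans (link-of-frame-link k m σ |σ|≡k k+m≤m+n face′)
  (≅-trans (link-cast dimensions (ℕP.+-comm k m))
           (link-↭ (↭-sym (Eframe↭stdFrame (m ℕ.+ k) (n ℕ.∸ k))))))
  where
  face′ : IsFace (Link (𝓑 (m ℕ.+ n)) (stdFrame (m ℕ.+ n) m)) σ
  face′ = linkFace σ _ (PartialFrame-↭ (↭P.++⁺ˡ σ (Eframe↭stdFrame m n)) (proj₂ face))
  k+m≤m+n : k ℕ.+ m ℕ.≤ m ℕ.+ n
  k+m≤m+n = subst (ℕ._≤ m ℕ.+ n) (ℕP.+-comm m k) (ℕP.+-monoʳ-≤ m k≤n)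
  dimensions : m ℕ.+ n ≡ (m ℕ.+ k) ℕ.+ (n ℕ.∸ k)
  dimensions = sym (trans (ℕP.+-assoc m k (n ℕ.∸ k)) (cong (m ℕ.+_) (ℕP.m+[n∸m]≡n k≤n)))
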